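{- Let $a\geq 3$ and $m\geq 2a^2-a+2$ be integers, let $C(m,a)=\left\lceil\frac{m-1}{a}\left\lceil\frac{m-1}{a}\right\rceil\right\rceil$, and suppose the set $\{1,\ldots,C(m,a)\}$ is colored red and blue so that there is no monochromatic solution of $x_1+\cdots+x_{m-1}=ax_m$, with $a-2$ red and $a-1$ blue. Then $m-2$ is red and $m-3$ is blue.
   Context: A solution is an assignment of values in $\{1,\ldots,C(m,a)\}$ to $x_1,\ldots,x_m$ (not necessarily distinct) making the equation true; it is monochromatic if all the values $x_1,\ldots,x_m$ have the same color. -}

module Defs where

open import Data.Nat using (ℕ; zero; suc; _+_; _*_; _∸_; _≤_)
open import Data.Nat.DivMod using (_/_)
open import Data.Fin using (Fin; zero; suc)
open import Data.Empty using (⊥)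
open import Data.Product using (∃; _×_)
open import Relation.Binary.PropositionalEquality using (_≡_)

data Colour : Set where
  red blue : Colour

-- ⌈ n / d ⌉ for d = suc k (positive divisor).
ceilDivSuc : ℕ → ℕ → ℕ
ceilDivSuc n k = (n + k) / suc k

-- C(m,a) = ⌈ ((m-1)/a) · ⌈(m-1)/a⌉ ⌉ = ⌈ (m-1)·⌈(m-1)/a⌉ / a ⌉.
-- (Junk value 0 when a = 0; the theorem assumes a ≥ 3.)
C : ℕ → ℕ → ℕ
C m zero    = 0
C m (suc k) = ceilDivSuc ((m ∸ 1) * ceilDivSuc (m ∸ 1) k) k

sumFin : ∀ {n} → (Fin n → ℕ) → ℕ
sumFin {zero}  x = 0
sumFin {suc n} x = x zero + sumFin (λ i → x (suc i))

-- A solution of x₁ + ⋯ + x_{m-1} = a·x_m in {1,…,N}: xs gives x₁..x_{m-1}, y gives x_m.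
IsSolution : (m a N : ℕ) → (Fin (m ∸ 1) → ℕ) → ℕ → Set
IsSolution m a N xs y =
  (∀ i → (1 ≤ xs i) × (xs i ≤ N)) × ((1 ≤ y) × (y ≤ N)) × (sumFin xs ≡ a * y)

Monochromatic : (ℕ → Colour) → ∀ {n} → (Fin n → ℕ) → ℕ → Set
Monochromatic c xs y = ∃ λ col → (∀ i → c (xs i) ≡ col) × (c y ≡ col)

-- No monochromatic solution in {1,…,N} (colouring only matters on {1,…,N}).
NoMonoSolution : (m a N : ℕ) → (ℕ → Colour) → Set
NoMonoSolution m a N c =
  ∀ (xs : Fin (m ∸ 1) → ℕ) (y : ℕ) → IsSolution m a N xs y → Monochromatic c xs y → ⊥

module Submission where

-- Write a = p + v and m = p + u + 1.  Then the tuple consisting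
-- of p copies of u followed by u copies of v, together with x_m = u, solves
-- x₁ + ⋯ + x_{m-1} = a·x_m, since p·u + u·v = (p + v)·u.  In a colouring with
-- no monochromatic solution, u therefore cannot share the colour of v.
--   * p = 1, u = m-2, v = a-1 : if m-2 were blue, like a-1, the solution
--     (m-2, a-1, …, a-1 ; m-2) would be blue; so m-2 is red.
--   * p = 2, u = m-3, v = a-2 : if m-3 were red, like a-2, the solution
--     (m-3, m-3, a-2, …, a-2 ; m-3) would be red; so m-3 is blue.
-- These solutions only use values below m, so they lie in {1,…,C(m,a)} once
-- C(m,a) ≥ m-1, which holds as soon as a² ≤ m-1; the hypothesis
-- m ≥ 2a² - a + 2 guarantees this.

open import Defs
open import Data.Nat using (ℕ; zero; suc; _+_; _*_; _∸_; _≤_; z≤n; s≤s; NonZero)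
open import Data.Nat.Properties
open import Data.Nat.DivMod using (_/_; m*n/n≡m; /-monoˡ-≤)
open import Data.Fin using (Fin; zero; suc)
open import Data.Product using (_×_; _,_)
open import Data.Empty using (⊥-elim)
open import Relation.Nullary using (¬_)
open import Relation.Binary.PropositionalEquality

sumFin-const : ∀ r v → sumFin {r} (λ _ → v) ≡ r * v
sumFin-const zero    v = refl
sumFin-const (suc r) v = cong (v +_) (sumFin-const r v)

blocks : ∀ p r → ℕ → ℕ → Fin (p + r) → ℕ
blocks zero    r u v _       = v
blocks (suc p) r u v zero    = u
blocks (suc p) r u v (suc i) = blocks p r u v i

sumFin-blocks : ∀ p r u v → sumFin (blocks p r u v) ≡ p * u + r * v
sumFin-blocks zero    r u v = sumFin-const r v
sumFin-blocks (suc p) r u v = begin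
  u + sumFin (blocks p r u v) ≡⟨ cong (u +_) (sumFin-blocks p r u v) ⟩
  u + (p * u + r * v)         ≡⟨ +-assoc u (p * u) (r * v) ⟨
  u + p * u + r * v           ∎
  where open ≡-Reasoning

blocks-all : ∀ (P : ℕ → Set) p r {u v} → P u → P v → ∀ i → P (blocks p r u v i)
blocks-all P zero    r Pu Pv _       = Pv
blocks-all P (suc p) r Pu Pv zero    = Pu
blocks-all P (suc p) r Pu Pv (suc i) = blocks-all P p r Pu Pv i

blockSolution : ∀ {N} p u v → 1 ≤ u → u ≤ N → 1 ≤ v → v ≤ N →
                IsSolution (suc (p + u)) (p + v) N (blocks p u u v) u
blockSolution {N} p u v 1≤u u≤N 1≤v v≤N =
  blocks-all (λ x → (1 ≤ x) × (x ≤ N)) p u (1≤u , u≤N) (1≤v , v≤N) ,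
  (1≤u , u≤N) ,
  (begin
    sumFin (blocks p u u v) ≡⟨ sumFin-blocks p u u v ⟩
    p * u + u * v           ≡⟨ cong (p * u +_) (*-comm u v) ⟩
    p * u + v * u           ≡⟨ *-distribʳ-+ u p v ⟨
    (p + v) * u             ∎)
  where open ≡-Reasoning

colourForced : ∀ {N} p u v (c : ℕ → Colour) {col : Colour} →
               NoMonoSolution (suc (p + u)) (p + v) N c →
               1 ≤ u → u ≤ N → 1 ≤ v → v ≤ N →
               c v ≡ col → ¬ (c u ≡ col)
colourForced p u v c {col} noMono 1≤u u≤N 1≤v v≤N cv cu =
  noMono (blocks p u u v) u (blockSolution p u v 1≤u u≤N 1≤v v≤N)
         (col , blocks-all (λ x → c x ≡ col) p u cu cv , cu)

red-if-not-blue : ∀ {x : Colour} → ¬ (x ≡ blue) → x ≡ red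
red-if-not-blue {red}  _  = refl
red-if-not-blue {blue} ne = ⊥-elim (ne refl)

blue-if-not-red : ∀ {x : Colour} → ¬ (x ≡ red) → x ≡ blue
blue-if-not-red {red}  ne = ⊥-elim (ne refl)
blue-if-not-red {blue} _  = refl

≤-ceilDiv : ∀ q n k → q * suc k ≤ n → q ≤ ceilDivSuc n k
≤-ceilDiv q n k qa≤n = begin
  q                 ≡⟨ m*n/n≡m q (suc k) ⟨
  q * suc k / suc k ≤⟨ /-monoˡ-≤ (suc k) (≤-trans qa≤n (m≤m+n n k)) ⟩
  (n + k) / suc k   ∎
  where open ≤-Reasoning

-- If a² ≤ n then ⌈n/a⌉ ≥ a, hence n·a ≤ n·⌈n/a⌉ and C(n+1,a) ≥ n.
C-lower : ∀ n k → suc k * suc k ≤ n → n ≤ C (suc n) (suc k)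
C-lower n k a²≤n = ≤-ceilDiv n (n * ceilDivSuc n k) k
  (*-monoʳ-≤ n (≤-ceilDiv (suc k) n k a²≤n))

-- The hypothesis m ≥ 2a² - a + 2 gives m ≥ a² + 2, because a ≤ a².
square+2≤ : ∀ a m .{{_ : NonZero a}} → 2 * a * a ∸ a + 2 ≤ m → 2 + a * a ≤ m
square+2≤ a m h = begin
  2 + a * a               ≡⟨ +-comm 2 (a * a) ⟩
  a * a + 2               ≡⟨ cong (_+ 2) (m+n∸n≡m (a * a) a) ⟨
  a * a + a ∸ a + 2       ≤⟨ +-monoˡ-≤ 2 (∸-monoˡ-≤ a a²+a≤2a²) ⟩
  2 * a * a ∸ a + 2       ≤⟨ h ⟩
  m                       ∎
  where
  open ≤-Reasoning
  a²+a≤2a² : a * a + a ≤ 2 * a * a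
  a²+a≤2a² = begin
    a * a + a             ≤⟨ +-monoʳ-≤ (a * a) (m≤m*n a a) ⟩
    a * a + a * a         ≡⟨ cong (a * a +_) (+-identityʳ (a * a)) ⟨
    a * a + (a * a + 0)   ≡⟨ *-assoc 2 a a ⟨
    2 * a * a             ∎

theorem : ∀ b k → (3 + b) * (3 + b) ≤ 3 + k →
          (c : ℕ → Colour) → NoMonoSolution (4 + k) (3 + b) (C (4 + k) (3 + b)) c →
          c (1 + b) ≡ red → c (2 + b) ≡ blue →
          (c (2 + k) ≡ red) × (c (1 + k) ≡ blue)
theorem b k a²≤m-1 c noMono a-2-red a-1-blue =
  red-if-not-blue (colourForced 1 (2 + k) (2 + b) c noMono
    (s≤s z≤n) m-2≤N (s≤s z≤n) a-1≤N a-1-blue) ,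
  blue-if-not-red (colourForced 2 (1 + k) (1 + b) c noMono
    (s≤s z≤n) m-3≤N (s≤s z≤n) a-2≤N a-2-red)
  where
  m-1≤N : 3 + k ≤ C (4 + k) (3 + b)
  m-1≤N = C-lower (3 + k) (2 + b) a²≤m-1
  m-2≤N : 2 + k ≤ C (4 + k) (3 + b)
  m-2≤N = ≤-trans (n≤1+n (2 + k)) m-1≤N
  m-3≤N : 1 + k ≤ C (4 + k) (3 + b)
  m-3≤N = ≤-trans (n≤1+n (1 + k)) m-2≤N
  a≤m-1 : 3 + b ≤ 3 + k
  a≤m-1 = ≤-trans (m≤m*n (3 + b) (3 + b)) a²≤m-1
  a-1≤N : 2 + b ≤ C (4 + k) (3 + b)
  a-1≤N = ≤-trans (n≤1+n (2 + b)) (≤-trans a≤m-1 m-1≤N)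
  a-2≤N : 1 + b ≤ C (4 + k) (3 + b)
  a-2≤N = ≤-trans (n≤1+n (1 + b)) a-1≤N

-- Writing a = b + 3 and m = k + 4 (possible since m ≥ a² + 2 ≥ 11) reduces
-- the statement to the version above.
lemma2 : (a m : ℕ) → 3 ≤ a → 2 * a * a ∸ a + 2 ≤ m →
         (c : ℕ → Colour) → NoMonoSolution m a (C m a) c →
         c (a ∸ 2) ≡ red → c (a ∸ 1) ≡ blue →
         (c (m ∸ 2) ≡ red) × (c (m ∸ 3) ≡ blue)
lemma2 a@(suc (suc (suc b))) m (s≤s (s≤s (s≤s z≤n))) bound c noMono a-2-red a-1-blue
  with square+2≤ a m bound
... | a²+2≤m with m≤n⇒∃[o]m+o≡n (≤-trans (s≤s (s≤s (s≤s (s≤s z≤n)))) a²+2≤m)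
...   | k , refl = theorem b k (m≤n⇒m≤1+n (≤-pred (≤-pred a²+2≤m)))
                     c noMono a-2-red a-1-blue
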